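{- Let $(\delta,K_1,K_2,C_0,C_1)$ be admissible parameters satisfying Case III, let $M$ be a magic distance, and let $\mathbf C$ be a metric cycle of odd perimeter with distances $a,b,x_1,\dots,x_k$ such that $a+b>2K_2+\sum_{i=1}^kx_i$. Then $a,b>K_2$, $\sum x_i\le K_1$ and $\sum x_i<K_2$. Furthermore, if $\sum x_i=K_1$, then $C\ge2\delta+K_1+2$ and $M>K_1$; so in all cases $\sum x_i<M$.
   Context: A $\delta$-edge-labelled cycle is a cycle graph (at least 3 vertices) with edge labels in $\{1,\dots,\delta\}$; it "has distances $d_1,\dots,d_m$" if its edges can be listed in some (arbitrary) order with these labels; its perimeter is the sum of labels. It is non-metric if some label exceeds the sum of the other labels, metric otherwise. Parameters: integers with $3\le\delta<\infty$, $1\le K_1\le K_2\le\delta$, $2\delta+2\le C_0,C_1\le3\delta+2$, $C_0$ even, $C_1$ odd; $C=\min(C_0,C_1)$, $C'=\max(C_0,C_1)$. Case III (admissible) means: $C>2\delta+K_1$, $K_1+2K_2\ge2\delta-1$, $3K_2\ge2\delta$, if $K_1+2K_2=2\delta-1$ then $C\ge2\delta+K_1+2$, and if $C'>C+1$ then $C\ge2\delta+K_2$. Magic distance: $M\in\{1,\dots,\delta\}$ with $\max(K_1,\lceil\delta/2\rceil)\le M\le\min(K_2,\lfloor(C-\delta-1)/2\rfloor)$, such that moreover $M>K_1$ if $K_1+2K_2=2\delta-1$, and $M<K_2$ if $C'>C+1$ and $C=2\delta+K_2$. -}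

module Defs where

open import Data.Nat using (ℕ; _+_; _*_; _∸_; _≤_; _<_; _>_; _≥_; ⌊_/2⌋; ⌈_/2⌉)
open import Data.Nat.Divisibility using (_∣_)
open import Data.List using (List; []; _∷_; _++_; length)
open import Data.Nat.ListAction using (sum)
open import Data.List.Relation.Unary.All using (All)
open import Data.List.Relation.Binary.Permutation.Propositional using (_↭_)
open import Data.Product using (_×_)
open import Relation.Binary.PropositionalEquality using (_≡_; _≢_)
open import Relation.Nullary using (¬_)

open import Data.Nat public using (_⊔_; _⊓_)

-- A δ-edge-labelled cycle: a cycle graph on n ≥ 3 vertices, given by the
-- list of its edge labels in cyclic order (a cycle on n vertices has n edges);
-- every label lies in {1,…,δ}.
record LabelledCycle (δ : ℕ) : Set where
  constructor mkCycle
  field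
    labels    : List ℕ
    atLeast3  : 3 ≤ length labels
    inRange   : All (λ d → 1 ≤ d × d ≤ δ) labels
open LabelledCycle public

HasDistances : ∀ {δ} → LabelledCycle δ → List ℕ → Set
HasDistances c ds = labels c ↭ ds

perimeter : ∀ {δ} → LabelledCycle δ → ℕ
perimeter c = sum (labels c)

Metric : ∀ {δ} → LabelledCycle δ → Set
Metric c = ∀ (pre post : List ℕ) (d : ℕ) →
  labels c ≡ pre ++ (d ∷ post) → d ≤ sum pre + sum post

Even : ℕ → Set
Even n = 2 ∣ n

Odd : ℕ → Set
Odd n = ¬ (2 ∣ n)

record Params (δ K₁ K₂ C₀ C₁ : ℕ) : Set where
  field
    δ≥3   : 3 ≤ δ
    K₁≥1  : 1 ≤ K₁
    K₁≤K₂ : K₁ ≤ K₂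
    K₂≤δ  : K₂ ≤ δ
    C₀-lo : 2 * δ + 2 ≤ C₀
    C₀-hi : C₀ ≤ 3 * δ + 2
    C₁-lo : 2 * δ + 2 ≤ C₁
    C₁-hi : C₁ ≤ 3 * δ + 2
    C₀-even : Even C₀
    C₁-odd  : Odd C₁

record CaseIII (δ K₁ K₂ C₀ C₁ : ℕ) : Set where
  C  = C₀ ⊓ C₁
  C' = C₀ ⊔ C₁
  field
    c1 : C > 2 * δ + K₁
    c2 : K₁ + 2 * K₂ ≥ 2 * δ ∸ 1
    c3 : 3 * K₂ ≥ 2 * δ
    c4 : K₁ + 2 * K₂ ≡ 2 * δ ∸ 1 → C ≥ 2 * δ + K₁ + 2
    c5 : C' > C + 1 → C ≥ 2 * δ + K₂

record Magic (δ K₁ K₂ C₀ C₁ M : ℕ) : Set where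
  C  = C₀ ⊓ C₁
  C' = C₀ ⊔ C₁
  field
    M≥1  : 1 ≤ M
    M≤δ  : M ≤ δ
    lo   : K₁ ⊔ ⌈ δ /2⌉ ≤ M
    hi   : M ≤ K₂ ⊓ ⌊ (C ∸ δ ∸ 1) /2⌋
    m1   : K₁ + 2 * K₂ ≡ 2 * δ ∸ 1 → M > K₁
    m2   : C' > C + 1 → C ≡ 2 * δ + K₂ → M < K₂

-- In a metric cycle each of a, b is at most the sum of the other labels, so the excess
-- a + b > 2K₂ + Σxᵢ forces both a and b above K₂. As a, b ≤ δ, the same excess gives
-- 2K₂ + Σxᵢ < 2δ, and the Case III inequalities K₁ + 2K₂ ≥ 2δ − 1 and 3K₂ ≥ 2δ then bound
-- Σxᵢ by K₁ and below K₂. Equality Σxᵢ = K₁ is only possible when K₁ + 2K₂ = 2δ − 1,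
-- the boundary case in which both Case III and the magic distance are strengthened.
module Submission where

open import Defs
open import Data.Nat using (ℕ; _+_; _*_; _≤_; _<_; _>_; _≥_; _⊓_; pred; _<?_)
open import Data.Nat.Properties
open import Data.List using (List; []; _∷_; _++_)
open import Data.Nat.ListAction using (sum)
open import Data.Nat.ListAction.Properties using (sum-↭; sum-++)
open import Data.List.Membership.Propositional.Properties using (∈-∃++)
open import Data.List.Relation.Binary.Permutation.Propositional using (_↭_; ↭-sym; ↭-swap; ↭-refl; ↭-trans)
open import Data.List.Relation.Binary.Permutation.Propositional.Properties using (∈-resp-↭; drop-mid)
open import Data.List.Relation.Unary.Any using (here)
import Data.List.Relation.Unary.All as All
open import Data.Product using (_×_; _,_; proj₂)
open import Data.Sum using (inj₁; inj₂)
open import Relation.Binary.PropositionalEquality using (_≡_; refl; sym; trans; cong; subst)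
open import Relation.Nullary using (yes; no; contradiction)

module _ {δ : ℕ} (c : LabelledCycle δ) {d : ℕ} {ds : List ℕ} (c∼ : HasDistances c (d ∷ ds)) where

  label≤δ : d ≤ δ
  label≤δ = proj₂ (All.lookup (inRange c) (∈-resp-↭ (↭-sym c∼) (here refl)))

  metric⇒label≤sum-others : Metric c → d ≤ sum ds
  metric⇒label≤sum-others metric with ∈-∃++ (∈-resp-↭ (↭-sym c∼) (here refl))
  ... | ys , zs , labels≡ = subst (d ≤_) sum-others≡ (metric ys zs d labels≡)
    where
    sum-others≡ : sum ys + sum zs ≡ sum ds
    sum-others≡ = trans (sym (sum-++ ys zs))
      (sum-↭ (drop-mid ys [] (subst (_↭ d ∷ ds) labels≡ c∼)))

+≤2* : ∀ {m n k} → m ≤ k → n ≤ k → m + n ≤ 2 * k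
+≤2* {m} {n} {k} m≤k n≤k = subst (m + n ≤_) (cong (k +_) (sym (+-identityʳ k))) (+-mono-≤ m≤k n≤k)

excess⇒< : ∀ k s a b → 2 * k + s < a + b → b ≤ a + s → k < a
excess⇒< k s a b excess b≤a+s with k <? a
... | yes k<a = k<a
... | no k≮a = contradiction excess (≤⇒≯ (begin
    a + b       ≤⟨ +-monoʳ-≤ a b≤a+s ⟩
    a + (a + s) ≡⟨ sym (+-assoc a a s) ⟩
    a + a + s   ≤⟨ +-monoˡ-≤ s (+≤2* (≮⇒≥ k≮a) (≮⇒≥ k≮a)) ⟩
    2 * k + s   ∎))
  where
  open ≤-Reasoning

module _ {m n p o : ℕ} (m+n<o : m + n < o) (o≤p+m+1 : pred o ≤ p + m) where

  ≤-from-excess : n ≤ p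
  ≤-from-excess = +-cancelʳ-≤ m n p
    (≤-trans (subst (_≤ pred o) (+-comm m n) (<⇒≤pred m+n<o)) o≤p+m+1)

  ≡-from-excess : n ≡ p → p + m ≡ pred o
  ≡-from-excess refl = ≤-antisym
    (subst (_≤ pred o) (+-comm m n) (<⇒≤pred m+n<o)) o≤p+m+1

mainTheorem6 : ∀ {δ K₁ K₂ C₀ C₁ M : ℕ} →
    Params δ K₁ K₂ C₀ C₁ → CaseIII δ K₁ K₂ C₀ C₁ → Magic δ K₁ K₂ C₀ C₁ M →
    (c : LabelledCycle δ) → Metric c → Odd (perimeter c) →
    (a b : ℕ) (xs : List ℕ) → HasDistances c (a ∷ b ∷ xs) →
    a + b > 2 * K₂ + sum xs →
    (a > K₂ × b > K₂) × sum xs ≤ K₁ × sum xs < K₂ ×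
    (sum xs ≡ K₁ → (C₀ ⊓ C₁ ≥ 2 * δ + K₁ + 2) × M > K₁) ×
    sum xs < M
mainTheorem6 {δ} {K₁} {K₂} {C₀} {C₁} {M} _ III magic c metric _ a b xs c∼ excess =
  (excess⇒< K₂ s a b excess b≤a+s , excess⇒< K₂ s b a (subst (2 * K₂ + s <_) (+-comm a b) excess) a≤b+s) ,
  s≤K₁ , s<K₂ , boundary , s<M
  where
  s = sum xs
  c∼b : HasDistances c (b ∷ a ∷ xs)
  c∼b = ↭-trans c∼ (↭-swap a b ↭-refl)
  a≤b+s : a ≤ b + s
  a≤b+s = metric⇒label≤sum-others c c∼ metric
  b≤a+s : b ≤ a + s
  b≤a+s = metric⇒label≤sum-others c c∼b metric
  excess<2δ : 2 * K₂ + s < 2 * δ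
  excess<2δ = <-≤-trans excess (+≤2* (label≤δ c c∼) (label≤δ c c∼b))
  s≤K₁ : s ≤ K₁
  s≤K₁ = ≤-from-excess excess<2δ (CaseIII.c2 III)
  s<K₂ : s < K₂
  s<K₂ = +-cancelˡ-< (2 * K₂) s K₂ (<-≤-trans excess<2δ
           (subst (2 * δ ≤_) (+-comm K₂ (2 * K₂)) (CaseIII.c3 III)))
  boundary : s ≡ K₁ → (C₀ ⊓ C₁ ≥ 2 * δ + K₁ + 2) × M > K₁
  boundary s≡K₁ = CaseIII.c4 III tight , Magic.m1 magic tight
    where
    tight : K₁ + 2 * K₂ ≡ pred (2 * δ)
    tight = ≡-from-excess excess<2δ (CaseIII.c2 III) s≡K₁
  s<M : s < M
  s<M with m≤n⇒m<n∨m≡n s≤K₁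
  ... | inj₁ s<K₁ = <-≤-trans s<K₁ (≤-trans (m≤m⊔n K₁ _) (Magic.lo magic))
  ... | inj₂ s≡K₁ = subst (_< M) (sym s≡K₁) (proj₂ (boundary s≡K₁))
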